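{- Let $\mathbf P=(P,\le,{}',0,1)$ be an orthoposet such that $\mathbf D_0(\mathbf P)$ is modular. Then: (i) $\mathbf P$ is strongly modular; (ii) if $M(x,y):=L(U(x,y'),y)$ and $R(x,y):=LU(L(x,y),x')$ for all $x,y\in P$, then $(P,\le,{}',M,R,0,1)$ is a divisible operator left residuated poset; (iii) there exists an extension ${}^*$ of $'$ to $D_0(\mathbf P)$ such that $(D_0(\mathbf P),\vee,\cap,{}^*,\{0\},P)$ is a modular ortholattice and hence an orthomodular lattice, and if one defines $A\odot B:=(A\vee B^*)\cap B$ and $A\rightarrow B:=(A\cap B)\vee A^*$ for all $A,B\in D_0(\mathbf P)$, then $(D_0(\mathbf P),\vee,\cap,\odot,\rightarrow,\{0\},P)$ is a divisible left residuated lattice.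
   Context: For $A\subseteq P$, $L(A)=\{x\in P\mid x\le y\ \forall y\in A\}$, $U(A)=\{x\in P\mid x\ge y\ \forall y\in A\}$; write $L(a,b)=L(\{a,b\})$, $L(a,A)=L(\{a\}\cup A)$, $L(A,B)=L(A\cup B)$, $LU(A)=L(U(A))$, etc. An orthoposet is a bounded poset with a unary operation $'$ that is a complementation ($U(x,x')=\{1\}$, $L(x,x')=\{0\}$) and an antitone involution. $\mathbf D(\mathbf P)$ is the Dedekind–MacNeille completion: $D(\mathbf P)=\{A\subseteq P\mid LU(A)=A\}$ ordered by inclusion, with $A\vee B=LU(A\cup B)$, $A\wedge B=A\cap B$, and $P$ embedded via $x\mapsto L(x)$; $\mathbf D_0(\mathbf P)$ is the sublattice of $\mathbf D(\mathbf P)$ generated by $\{L(x)\mid x\in P\}$. A poset is strongly modular if for all $x,y,z$: $L(U(x,y),U(x,z))=LU(x,L(y,U(x,z)))$ and $L(U(L(x,z),y),z)=LU(L(x,z),L(y,z))$. An operator left residuated poset is $(P,\le,{}',M,R,0,1)$ with $(P,\le,{}',0,1)$ a bounded poset with unary operation and $M,R:P^2\to2^P$ such that for all $x,y,z$: $M(x,1)=M(1,x)=L(x)$; $M(x,y)\subseteq L(z)$ iff $L(x)\subseteq R(y,z)$; $R(x,0)=L(x')$; it is divisible if $M(R(x,y),x)=L(x,y)$ (with $M(A,y)=L(U(A,y'),y)$ for sets $A$). An ortholattice is a bounded lattice with a complementation that is an antitone involution; orthomodular if moreover $x\vee((x\vee y)\wedge x')=x\vee y$. A left residuated lattice is $(L,\vee,\wedge,\odot,\rightarrow,0,1)$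 with $(L,\vee,\wedge,0,1)$ a bounded lattice, $x\odot1=1\odot x=x$, and $x\odot y\le z$ iff $x\le y\rightarrow z$; divisible if $(x\rightarrow y)\odot x=x\wedge y$. -}

module Defs where

open import Level using (0ℓ)
open import Data.Product using (Σ; Σ-syntax; ∃; _×_; _,_; proj₁)
open import Data.Unit using (⊤)
open import Relation.Binary using (Rel; IsPartialOrder)
open import Relation.Binary.PropositionalEquality using (_≡_)
open import Relation.Unary using (Pred; _⊆_; _≐_; _∪_; _∩_; ｛_｝)
open import Function.Bundles using (_⇔_)
open import Algebra.Lattice.Structures using (IsLattice)

-- Orthoposets (carrier equality is propositional equality; subsets of the
-- carrier are predicates, and equality of subsets is extensional, _≐_)

record Orthoposet : Set₁ where
  field
    Carrier        : Set
    _≤_            : Rel Carrier 0ℓ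
    isPartialOrder : IsPartialOrder _≡_ _≤_
    𝟘 𝟙            : Carrier
    𝟘-min          : ∀ x → 𝟘 ≤ x
    𝟙-max          : ∀ x → x ≤ 𝟙
    _′             : Carrier → Carrier

  L : Pred Carrier 0ℓ → Pred Carrier 0ℓ
  L A x = ∀ y → A y → x ≤ y

  U : Pred Carrier 0ℓ → Pred Carrier 0ℓ
  U A x = ∀ y → A y → y ≤ x

  LU : Pred Carrier 0ℓ → Pred Carrier 0ℓ
  LU A = L (U A)

  ⟪_,_⟫ : Carrier → Carrier → Pred Carrier 0ℓ
  ⟪ x , y ⟫ = ｛ x ｝ ∪ ｛ y ｝

  field
    compl-U   : ∀ x → U ⟪ x , x ′ ⟫ ≐ ｛ 𝟙 ｝
    compl-L   : ∀ x → L ⟪ x , x ′ ⟫ ≐ ｛ 𝟘 ｝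
    antitone  : ∀ {x y} → x ≤ y → (y ′) ≤ (x ′)
    involutive : ∀ x → (x ′) ′ ≡ x

module OrthoposetTheory (𝐏 : Orthoposet) where
  open Orthoposet 𝐏

  P : Set
  P = Carrier

  Sub : Set₁
  Sub = Pred P 0ℓ

  Whole : Sub
  Whole = λ _ → ⊤

  -- Dedekind–MacNeille completion D(P): join is LU(A ∪ B), meet is A ∩ B,
  -- x is embedded as L(x).  D₀(P) is the sublattice generated by the L(x):
  -- the subsets (up to extensional equality) denoted by lattice terms.

  Lx : P → Sub
  Lx x = L ｛ x ｝

  _⊔D_ : Sub → Sub → Sub
  A ⊔D B = LU (A ∪ B)

  data InD₀ : Sub → Set₁ where
    gen  : ∀ x → InD₀ (Lx x)
    join : ∀ {A B} → InD₀ A → InD₀ B → InD₀ (A ⊔D B)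
    meet : ∀ {A B} → InD₀ A → InD₀ B → InD₀ (A ∩ B)
    ext  : ∀ {A B} → A ≐ B → InD₀ A → InD₀ B

  D₀ : Set₁
  D₀ = Σ[ A ∈ Sub ] InD₀ A

  _≈_ : D₀ → D₀ → Set
  X ≈ Y = proj₁ X ≐ proj₁ Y

  _⊑_ : D₀ → D₀ → Set
  X ⊑ Y = proj₁ X ⊆ proj₁ Y

  _∨_ : D₀ → D₀ → D₀
  (A , a) ∨ (B , b) = (A ⊔D B) , join a b

  _∧_ : D₀ → D₀ → D₀
  (A , a) ∧ (B , b) = (A ∩ B) , meet a b

  ι : P → D₀
  ι x = Lx x , gen x

  -- {0} = L(0) and P = L(1)
  ⊥D : D₀
  ⊥D = ι 𝟘

  ⊤D : D₀
  ⊤D = ι 𝟙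

  IsModularD₀ : Set₁
  IsModularD₀ = ∀ X Y Z → X ⊑ Z → (X ∨ (Y ∧ Z)) ≈ ((X ∨ Y) ∧ Z)

  -- strong modularity (L(a,b) = L({a,b}), L(a,A) = L({a} ∪ A), ...)

  IsStronglyModular : Set
  IsStronglyModular = ∀ x y z →
      (L (U ⟪ x , y ⟫ ∪ U ⟪ x , z ⟫) ≐ LU (｛ x ｝ ∪ L (｛ y ｝ ∪ U ⟪ x , z ⟫)))
    × (L (U (L ⟪ x , z ⟫ ∪ ｛ y ｝) ∪ ｛ z ｝) ≐ LU (L ⟪ x , z ⟫ ∪ L ⟪ y , z ⟫))

  Mset : Sub → P → Sub
  Mset A y = L (U (A ∪ ｛ y ′ ｝) ∪ ｛ y ｝)

  record IsOperatorLeftResiduated (M R : P → P → Sub) : Set₁ where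
    field
      M-1ʳ     : ∀ x → M x 𝟙 ≐ Lx x
      M-1ˡ     : ∀ x → M 𝟙 x ≐ Lx x
      residual : ∀ x y z → (M x y ⊆ Lx z) ⇔ (Lx x ⊆ R y z)
      R-0      : ∀ x → R x 𝟘 ≐ Lx (x ′)

  IsDivisibleOLR : (M R : P → P → Sub) → Set₁
  IsDivisibleOLR M R =
    IsOperatorLeftResiduated M R × (∀ x y → Mset (R x y) x ≐ L ⟪ x , y ⟫)

  record IsOrtholatticeD₀ (_* : D₀ → D₀) : Set₁ where
    field
      isLattice  : IsLattice _≈_ _∨_ _∧_
      ⊥-least    : ∀ X → ⊥D ⊑ X
      ⊤-greatest : ∀ X → X ⊑ ⊤D
      *-cong     : ∀ {X Y} → X ≈ Y → (X *) ≈ (Y *)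
      compl-∨    : ∀ X → (X ∨ (X *)) ≈ ⊤D
      compl-∧    : ∀ X → (X ∧ (X *)) ≈ ⊥D
      antitone   : ∀ {X Y} → X ⊑ Y → (Y *) ⊑ (X *)
      involutive : ∀ X → ((X *) *) ≈ X

  IsModularLattice : Set₁
  IsModularLattice = ∀ X Y Z → X ⊑ Z → (X ∨ (Y ∧ Z)) ≈ ((X ∨ Y) ∧ Z)

  IsOrthomodularD₀ : (D₀ → D₀) → Set₁
  IsOrthomodularD₀ _* = IsOrtholatticeD₀ _*
    × (∀ X Y → (X ∨ ((X ∨ Y) ∧ (X *))) ≈ (X ∨ Y))

  record IsDivisibleLeftResiduatedD₀ (_⊙_ _⇒_ : D₀ → D₀ → D₀) : Set₁ where
    field
      isLattice  : IsLattice _≈_ _∨_ _∧_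
      ⊥-least    : ∀ X → ⊥D ⊑ X
      ⊤-greatest : ∀ X → X ⊑ ⊤D
      ⊙-1ʳ       : ∀ X → (X ⊙ ⊤D) ≈ X
      ⊙-1ˡ       : ∀ X → (⊤D ⊙ X) ≈ X
      residual   : ∀ X Y Z → ((X ⊙ Y) ⊑ Z) ⇔ (X ⊑ (Y ⇒ Z))
      divisible  : ∀ X Y → ((X ⇒ Y) ⊙ X) ≈ (X ∧ Y)

module Submission where

-- Everything is lattice theory in D₀(P). The orthocomplement extends to subsets by A * = L(A′);
-- by De Morgan on generators it maps D₀(P) to itself and makes it an ortholattice. In any
-- modular lattice with a complement ᗮ, the Sasaki operations x ⊙ y = (x ∨ yᗮ) ∧ y and
-- y ⇒ z = (y ∧ z) ∨ yᗮ are residuated: x ⊙ y ≤ z iff x ≤ y ⇒ z, because modularity with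
-- yᗮ as complement of y gives ((y ∧ z) ∨ yᗮ) ∧ y = y ∧ z and x ∨ yᗮ ≤ yᗮ ∨ (y ∧ (x ∨ yᗮ)).
-- Divisibility and orthomodularity are further instances of the same two modular identities.
-- Parts (i) and (ii) are these lattice facts read on the generators L(x), since every cone
-- expression occurring in them is a join or meet of such generators.

open import Level using (0ℓ; suc; _⊔_)
open import Data.Product using (Σ-syntax; _×_; _,_; proj₁; proj₂; <_,_>)
open import Data.Sum using (inj₁; inj₂; [_,_])
open import Function.Base using (_∘_)
open import Function.Bundles using (_⇔_; mk⇔)
open import Function.Properties.Equivalence using () renaming (trans to ⇔-trans)
open import Relation.Binary using (IsPartialOrder)
import Relation.Binary.Construct.On as On
open import Relation.Binary.Lattice using (BoundedLattice)
import Relation.Binary.Lattice.Properties.JoinSemilattice as JoinProperties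
import Relation.Binary.Lattice.Properties.MeetSemilattice as MeetProperties
open import Relation.Binary.Lattice.Properties.Lattice using (isAlgLattice)
open import Relation.Binary.PropositionalEquality using (_≡_; refl; sym; subst)
import Relation.Binary.Reasoning.PartialOrder as ≤-Reasoning
import Relation.Binary.Reasoning.Setoid as SetoidReasoning
open import Relation.Unary using (_≐_; _⊆_; _∪_; _∩_; ｛_｝)
open import Relation.Unary.Properties using (≐-refl; ≐-sym; ≐-trans)
open import Relation.Unary.Relation.Binary.Equality using (≐-setoid)
open import Relation.Unary.Relation.Binary.Subset using (⊆-isPartialOrder)

open import Defs

module ModularBoundedLattice {c ℓ₁ ℓ₂} (𝐋 : BoundedLattice c ℓ₁ ℓ₂) where
  open BoundedLattice 𝐋
    renaming (refl to ≤-refl; trans to ≤-trans; reflexive to ≤-reflexive)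
  open JoinProperties joinSemilattice using (∨-monotonic; ∨-comm)
  open MeetProperties meetSemilattice using (∧-monotonic; ∧-comm)
  open ≤-Reasoning poset

  IsModular : Set (c ⊔ ℓ₂)
  IsModular = ∀ x y z → x ≤ z → (x ∨ y) ∧ z ≤ x ∨ (y ∧ z)

  module _ (modular : IsModular) where

    modular-⊤ : ∀ {x y z} → x ≤ z → ⊤ ≤ x ∨ y → z ≤ x ∨ (y ∧ z)
    modular-⊤ {x} {y} {z} x≤z ⊤≤x∨y = begin
      z                ≤⟨ ∧-greatest (≤-trans (maximum z) ⊤≤x∨y) ≤-refl ⟩
      (x ∨ y) ∧ z      ≤⟨ modular x y z x≤z ⟩
      x ∨ (y ∧ z)      ∎

    modular-⊥ : ∀ {x y z} → x ≤ z → y ∧ z ≤ ⊥ → (x ∨ y) ∧ z ≤ x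
    modular-⊥ {x} {y} {z} x≤z y∧z≤⊥ = begin
      (x ∨ y) ∧ z      ≤⟨ modular x y z x≤z ⟩
      x ∨ (y ∧ z)      ≤⟨ ∨-least ≤-refl (≤-trans y∧z≤⊥ (minimum x)) ⟩
      x                ∎

    module Complemented
      (_ᗮ : Carrier → Carrier)
      (ᗮ-join : ∀ x → ⊤ ≤ x ∨ x ᗮ)
      (ᗮ-meet : ∀ x → x ∧ x ᗮ ≤ ⊥)
      where

      _⊙_ : Carrier → Carrier → Carrier
      x ⊙ y = (x ∨ y ᗮ) ∧ y

      _⇒_ : Carrier → Carrier → Carrier
      x ⇒ y = (x ∧ y) ∨ x ᗮ

      ᗮ-joinˡ : ∀ x → ⊤ ≤ x ᗮ ∨ x
      ᗮ-joinˡ x = ≤-trans (ᗮ-join x) (≤-reflexive (∨-comm x (x ᗮ)))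

      ᗮ-meetˡ : ∀ x → x ᗮ ∧ x ≤ ⊥
      ᗮ-meetˡ x = ≤-trans (≤-reflexive (∧-comm (x ᗮ) x)) (ᗮ-meet x)

      orthomodular : ∀ x y → x ∨ ((x ∨ y) ∧ x ᗮ) ≈ x ∨ y
      orthomodular x y = antisym (∨-least (x≤x∨y x y) (x∧y≤x (x ∨ y) (x ᗮ))) (begin
        x ∨ y                    ≤⟨ modular-⊤ (x≤x∨y x y) (ᗮ-join x) ⟩
        x ∨ (x ᗮ ∧ (x ∨ y))      ≤⟨ ∨-monotonic ≤-refl (≤-reflexive (∧-comm (x ᗮ) (x ∨ y))) ⟩
        x ∨ ((x ∨ y) ∧ x ᗮ)      ∎)

      ⊙-residual : ∀ {x y z} → x ⊙ y ≤ z → x ≤ y ⇒ z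
      ⊙-residual {x} {y} {z} x⊙y≤z = begin
        x                         ≤⟨ x≤x∨y x (y ᗮ) ⟩
        x ∨ y ᗮ                   ≤⟨ modular-⊤ (y≤x∨y x (y ᗮ)) (ᗮ-joinˡ y) ⟩
        y ᗮ ∨ (y ∧ (x ∨ y ᗮ))     ≤⟨ ∨-monotonic ≤-refl y∧[x∨yᗮ]≤y∧z ⟩
        y ᗮ ∨ (y ∧ z)             ≤⟨ ≤-reflexive (∨-comm (y ᗮ) (y ∧ z)) ⟩
        y ⇒ z                     ∎
        where
        y∧[x∨yᗮ]≤y∧z : y ∧ (x ∨ y ᗮ) ≤ y ∧ z
        y∧[x∨yᗮ]≤y∧z = ∧-greatest (x∧y≤x y _) (≤-trans (≤-reflexive (∧-comm y _)) x⊙y≤z)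

      ⇒-residual : ∀ {x y z} → x ≤ y ⇒ z → x ⊙ y ≤ z
      ⇒-residual {x} {y} {z} x≤y⇒z = begin
        (x ∨ y ᗮ) ∧ y             ≤⟨ ∧-monotonic (∨-least x≤y⇒z (y≤x∨y (y ∧ z) (y ᗮ))) ≤-refl ⟩
        ((y ∧ z) ∨ y ᗮ) ∧ y       ≤⟨ modular-⊥ (x∧y≤x y z) (ᗮ-meetˡ y) ⟩
        y ∧ z                     ≤⟨ x∧y≤y y z ⟩
        z                         ∎

      residuated : ∀ x y z → (x ⊙ y ≤ z) ⇔ (x ≤ y ⇒ z)
      residuated x y z = mk⇔ ⊙-residual ⇒-residual

      divisible : ∀ x y → (x ⇒ y) ⊙ x ≈ x ∧ y
      divisible x y = antisym
        (∧-greatest (x∧y≤y _ x) (⇒-residual ≤-refl))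
        (∧-greatest (≤-trans (x≤x∨y (x ∧ y) (x ᗮ)) (x≤x∨y (x ⇒ y) (x ᗮ))) (x∧y≤x x y))

      ⊙-identityʳ : ∀ x → x ⊙ ⊤ ≈ x
      ⊙-identityʳ x = antisym
        (modular-⊥ (maximum x) (ᗮ-meetˡ ⊤))
        (∧-greatest (x≤x∨y x (⊤ ᗮ)) (maximum x))

      ⊙-identityˡ : ∀ x → ⊤ ⊙ x ≈ x
      ⊙-identityˡ x = antisym
        (x∧y≤y (⊤ ∨ x ᗮ) x)
        (∧-greatest (≤-trans (maximum x) (x≤x∨y ⊤ (x ᗮ))) ≤-refl)

      ⇒-⊥ : ∀ x → x ⇒ ⊥ ≈ x ᗮ
      ⇒-⊥ x = antisym
        (∨-least (≤-trans (x∧y≤y x ⊥) (minimum (x ᗮ))) ≤-refl)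
        (y≤x∨y (x ∧ ⊥) (x ᗮ))

module OrthoposetCompletion (𝐏 : Orthoposet) where
  open Orthoposet 𝐏
  open OrthoposetTheory 𝐏
  open IsPartialOrder isPartialOrder using ()
    renaming (refl to ≤-refl; reflexive to ≤-reflexive; trans to ≤-trans)
  module ≐-Reasoning = SetoidReasoning (≐-setoid P 0ℓ)

  private variable
    x y : P
    A A′ B B′ : Sub

  ≤′-swap : x ≤ (y ′) → y ≤ (x ′)
  ≤′-swap {x} {y} x≤y′ = subst (_≤ (x ′)) (involutive y) (antitone x≤y′)

  ′≤-swap : (x ′) ≤ y → (y ′) ≤ x
  ′≤-swap {x} {y} x′≤y = subst ((y ′) ≤_) (involutive x) (antitone x′≤y)

  ′≤′⇒≥ : (x ′) ≤ (y ′) → y ≤ x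
  ′≤′⇒≥ {x} {y} x′≤y′ = subst (_≤ x) (involutive y) (′≤-swap x′≤y′)

  x≤x′⇒x≡𝟘 : x ≤ (x ′) → x ≡ 𝟘
  x≤x′⇒x≡𝟘 {x} x≤x′ = sym (proj₁ (compl-L x) λ { _ (inj₁ refl) → ≤-refl ; _ (inj₂ refl) → x≤x′ })

  x′≤x⇒x≡𝟙 : (x ′) ≤ x → x ≡ 𝟙
  x′≤x⇒x≡𝟙 {x} x′≤x = sym (proj₁ (compl-U x) λ { _ (inj₁ refl) → ≤-refl ; _ (inj₂ refl) → x′≤x })

  ∩-cong : A ≐ A′ → B ≐ B′ → A ∩ B ≐ A′ ∩ B′
  ∩-cong (A⊆A′ , A′⊆A) (B⊆B′ , B′⊆B) =
    (λ (a , b) → A⊆A′ a , B⊆B′ b) , (λ (a , b) → A′⊆A a , B′⊆B b)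

  ⊆-respˡ-≐ : A ≐ A′ → (A ⊆ B) ⇔ (A′ ⊆ B)
  ⊆-respˡ-≐ (A⊆A′ , A′⊆A) =
    mk⇔ (λ A⊆B {_} x∈A′ → A⊆B (A′⊆A x∈A′)) (λ A′⊆B {_} x∈A → A′⊆B (A⊆A′ x∈A))

  ⊆-respʳ-≐ : B ≐ B′ → (A ⊆ B) ⇔ (A ⊆ B′)
  ⊆-respʳ-≐ (B⊆B′ , B′⊆B) =
    mk⇔ (λ A⊆B {_} x∈A → B⊆B′ (A⊆B x∈A)) (λ A⊆B′ {_} x∈A → B′⊆B (A⊆B′ x∈A))

  L-antitone : A ⊆ B → L B ⊆ L A
  L-antitone A⊆B x∈LB y y∈A = x∈LB y (A⊆B y∈A)

  U-antitone : A ⊆ B → U B ⊆ U A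
  U-antitone A⊆B x∈UB y y∈A = x∈UB y (A⊆B y∈A)

  LU-monotone : A ⊆ B → LU A ⊆ LU B
  LU-monotone A⊆B = L-antitone (U-antitone A⊆B)

  ⊆-LU : A ⊆ LU A
  ⊆-LU x∈A u u∈UA = u∈UA _ x∈A

  L-cong : A ≐ B → L A ≐ L B
  L-cong (A⊆B , B⊆A) = L-antitone B⊆A , L-antitone A⊆B

  U-cong : A ≐ B → U A ≐ U B
  U-cong (A⊆B , B⊆A) = U-antitone B⊆A , U-antitone A⊆B

  L-∪ : L (A ∪ B) ≐ L A ∩ L B
  L-∪ = (λ x∈L → (λ y → x∈L y ∘ inj₁) , (λ y → x∈L y ∘ inj₂))
      , (λ (x∈LA , x∈LB) y → [ x∈LA y , x∈LB y ])

  U-∪ : U (A ∪ B) ≐ U A ∩ U B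
  U-∪ = (λ x∈U → (λ y → x∈U y ∘ inj₁) , (λ y → x∈U y ∘ inj₂))
      , (λ (x∈UA , x∈UB) y → [ x∈UA y , x∈UB y ])

  U-∪-cong : U A ≐ U A′ → U B ≐ U B′ → U (A ∪ B) ≐ U (A′ ∪ B′)
  U-∪-cong UA≐UA′ UB≐UB′ = ≐-trans U-∪ (≐-trans (∩-cong UA≐UA′ UB≐UB′) (≐-sym U-∪))

  Lx-intro : y ≤ x → Lx x y
  Lx-intro {y} y≤x _ refl = y≤x

  Lx-elim : Lx x y → y ≤ x
  Lx-elim y∈Lx = y∈Lx _ refl

  U-｛｝ : U ｛ x ｝ ≐ U (Lx x)
  U-｛｝ = (λ x≤u y y∈Lx → ≤-trans (Lx-elim y∈Lx) (x≤u _ refl))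
         , (λ u∈U _ x≡y → subst (_≤ _) x≡y (u∈U _ (Lx-intro ≤-refl)))

  Closed : Sub → Set
  Closed A = LU A ⊆ A

  L-closed : Closed (L A)
  L-closed x∈LUL y y∈A = x∈LUL y (λ _ z∈LA → z∈LA y y∈A)

  InD₀⇒Closed : InD₀ A → Closed A
  InD₀⇒Closed (gen _)                  = L-closed
  InD₀⇒Closed (join _ _)               = L-closed
  InD₀⇒Closed (meet a b) x∈LU          =
    InD₀⇒Closed a (LU-monotone proj₁ x∈LU) , InD₀⇒Closed b (LU-monotone proj₂ x∈LU)
  InD₀⇒Closed (ext (A⊆B , B⊆A) a) x∈LU = A⊆B (InD₀⇒Closed a (LU-monotone B⊆A x∈LU))

  -- A * is the paper's L(A′): λ b → A (b ′) is the image {a ′ | a ∈ A}, as ′ is an involution.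
  _* : Sub → Sub
  A * = L (λ b → A (b ′))

  infix 25 _*

  *-antitone : A ⊆ B → B * ⊆ A *
  *-antitone A⊆B = L-antitone A⊆B

  *-cong : A ≐ B → A * ≐ B *
  *-cong {A} {B} (A⊆B , B⊆A) = *-antitone {B} {A} B⊆A , *-antitone {A} {B} A⊆B

  ∈⇒′′∈ : A x → A ((x ′) ′)
  ∈⇒′′∈ {A} {x} = subst A (sym (involutive x))

  U⇒′∈* : U A x → (A *) (x ′)
  U⇒′∈* x∈UA b b′∈A = ′≤-swap (x∈UA (b ′) b′∈A)

  *-involutive : Closed A → A * * ≐ A
  *-involutive {A} A-closed =
      (λ x∈A** → A-closed λ u u∈UA → x∈A** u (U⇒′∈* u∈UA))
    , (λ {a} a∈A b b′∈A* → ′≤′⇒≥ (b′∈A* (a ′) (∈⇒′′∈ {A} a∈A)))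

  Lx-* : ∀ x → Lx x * ≐ Lx (x ′)
  Lx-* x = (λ y∈Lx* → Lx-intro (y∈Lx* (x ′) (Lx-intro (≤-reflexive (involutive x)))))
         , (λ y∈Lx′ b b′∈Lx → ≤-trans (Lx-elim y∈Lx′) (′≤-swap (Lx-elim b′∈Lx)))

  LU-* : LU A * ≐ A *
  LU-* {A} = *-antitone {A} {LU A} ⊆-LU
           , λ {y} y∈A* b b′∈LUA → ′≤′⇒≥ (b′∈LUA (y ′) (y′∈UA y∈A*))
    where
    y′∈UA : ∀ {y} → (A *) y → U A (y ′)
    y′∈UA y∈A* a a∈A = ≤′-swap (y∈A* (a ′) (∈⇒′′∈ {A} a∈A))

  ∪-* : (A ∪ B) * ≐ A * ∩ B *
  ∪-* = L-∪

  ∩-* : Closed A → Closed B → (A ∩ B) * ≐ A * ⊔D B *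
  ∩-* {A} {B} A-closed B-closed = begin
    (A ∩ B) *                 ≈⟨ *-cong (∩-cong (*-involutive A-closed) (*-involutive B-closed)) ⟨
    (A * * ∩ B * *) *         ≈⟨ *-cong (∪-* {A *} {B *}) ⟨
    (A * ∪ B *) * *           ≈⟨ *-cong (LU-* {A * ∪ B *}) ⟨
    LU (A * ∪ B *) * *        ≈⟨ *-involutive L-closed ⟩
    LU (A * ∪ B *)            ∎
    where
    open ≐-Reasoning

  InD₀-* : InD₀ A → InD₀ (A *)
  InD₀-* (gen x)            = ext (≐-sym (Lx-* x)) (gen (x ′))
  InD₀-* (join {A} {B} a b) = ext (≐-sym (≐-trans (LU-* {A ∪ B}) (∪-* {A} {B})))
                                  (meet (InD₀-* a) (InD₀-* b))
  InD₀-* (meet a b)         = ext (≐-sym (∩-* (InD₀⇒Closed a) (InD₀⇒Closed b)))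
                                  (join (InD₀-* a) (InD₀-* b))
  InD₀-* (ext A≐B a)        = ext (*-cong A≐B) (InD₀-* a)

  star : D₀ → D₀
  star (A , a) = A * , InD₀-* a

  D₀-closed : (X : D₀) → Closed (proj₁ X)
  D₀-closed (_ , a) = InD₀⇒Closed a

  ⊥D-least : ∀ X → ⊥D ⊑ X
  ⊥D-least X y∈L𝟘 = D₀-closed X λ u _ → ≤-trans (Lx-elim y∈L𝟘) (𝟘-min u)

  ⊤D-greatest : ∀ X → X ⊑ ⊤D
  ⊤D-greatest X _ = Lx-intro (𝟙-max _)

  D₀-boundedLattice : BoundedLattice (suc 0ℓ) 0ℓ 0ℓ
  D₀-boundedLattice = record
    { _≈_ = _≈_
    ; _≤_ = _⊑_
    ; _∨_ = _∨_
    ; _∧_ = _∧_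
    ; ⊤ = ⊤D
    ; ⊥ = ⊥D
    ; isBoundedLattice = record
      { isLattice = record
        { isPartialOrder = On.isPartialOrder proj₁ ⊆-isPartialOrder
        ; supremum = λ X Y → ⊆-LU ∘ inj₁ , ⊆-LU ∘ inj₂
                           , λ Z X⊑Z Y⊑Z → D₀-closed Z ∘ LU-monotone [ X⊑Z , Y⊑Z ]
        ; infimum = λ X Y → proj₁ , proj₂ , λ Z Z⊑X Z⊑Y → < Z⊑X , Z⊑Y >
        }
      ; maximum = ⊤D-greatest
      ; minimum = ⊥D-least
      }
    }

  star-join : ∀ X → ⊤D ⊑ (X ∨ star X)
  star-join X {y} y∈L𝟙 u u∈U = subst (y ≤_) (sym u≡𝟙) (Lx-elim y∈L𝟙)
    where
    u≡𝟙 : u ≡ 𝟙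
    u≡𝟙 = x′≤x⇒x≡𝟙 (u∈U (u ′) (inj₂ (U⇒′∈* λ a a∈X → u∈U a (inj₁ a∈X))))

  star-meet : ∀ X → (X ∧ star X) ⊑ ⊥D
  star-meet X (y∈X , y∈X*) = Lx-intro (≤-reflexive (x≤x′⇒x≡𝟘 (y∈X* (_ ′) (∈⇒′′∈ {proj₁ X} y∈X))))

  isOrtholattice : IsOrtholatticeD₀ star
  isOrtholattice = record
    { isLattice  = isAlgLattice (BoundedLattice.lattice D₀-boundedLattice)
    ; ⊥-least    = ⊥D-least
    ; ⊤-greatest = ⊤D-greatest
    ; *-cong     = *-cong
    ; compl-∨    = λ X → ⊤D-greatest (X ∨ star X) , star-join X
    ; compl-∧    = λ X → star-meet X , ⊥D-least (X ∧ star X)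
    ; antitone   = *-antitone
    ; involutive = λ X → *-involutive (D₀-closed X)
    }

  L-⟪⟫ : L ⟪ x , y ⟫ ≐ proj₁ (ι x ∧ ι y)
  L-⟪⟫ = L-∪

  LU-⟪⟫ : LU ⟪ x , y ⟫ ≐ proj₁ (ι x ∨ ι y)
  LU-⟪⟫ = L-cong (U-∪-cong U-｛｝ U-｛｝)

  U-｛′｝ : U ｛ x ′ ｝ ≐ U (proj₁ (star (ι x)))
  U-｛′｝ {x} = ≐-trans U-｛｝ (U-cong (≐-sym (Lx-* x)))

  M : P → P → Sub
  M x y = L (U ⟪ x , y ′ ⟫ ∪ ｛ y ｝)

  R : P → P → Sub
  R x y = LU (L ⟪ x , y ⟫ ∪ ｛ x ′ ｝)

  module Modular (modular : IsModularD₀) where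
    open ModularBoundedLattice D₀-boundedLattice using (IsModular; module Complemented)

    modular-⊑ : IsModular
    modular-⊑ X Y Z X⊑Z = proj₂ (modular X Y Z X⊑Z)

    open Complemented modular-⊑ star star-join star-meet public
      using (_⊙_; _⇒_; orthomodular)
    open Complemented modular-⊑ star star-join star-meet
      using (residuated; divisible; ⊙-identityʳ; ⊙-identityˡ; ⇒-⊥)
    open ≐-Reasoning

    stronglyModular₁ : ∀ x y z →
      L (U ⟪ x , y ⟫ ∪ U ⟪ x , z ⟫) ≐ LU (｛ x ｝ ∪ L (｛ y ｝ ∪ U ⟪ x , z ⟫))
    stronglyModular₁ x y z = begin
      L (U ⟪ x , y ⟫ ∪ U ⟪ x , z ⟫)
        ≈⟨ ≐-trans L-∪ (∩-cong LU-⟪⟫ LU-⟪⟫) ⟩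
      proj₁ ((ι x ∨ ι y) ∧ (ι x ∨ ι z))
        ≈⟨ modular (ι x) (ι y) (ι x ∨ ι z) (⊆-LU ∘ inj₁) ⟨
      proj₁ (ι x ∨ (ι y ∧ (ι x ∨ ι z)))
        ≈⟨ L-cong (U-∪-cong U-｛｝ (U-cong (≐-trans L-∪ (∩-cong ≐-refl LU-⟪⟫)))) ⟨
      LU (｛ x ｝ ∪ L (｛ y ｝ ∪ U ⟪ x , z ⟫))
        ∎

    stronglyModular₂ : ∀ x y z →
      L (U (L ⟪ x , z ⟫ ∪ ｛ y ｝) ∪ ｛ z ｝) ≐ LU (L ⟪ x , z ⟫ ∪ L ⟪ y , z ⟫)
    stronglyModular₂ x y z = begin
      L (U (L ⟪ x , z ⟫ ∪ ｛ y ｝) ∪ ｛ z ｝)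
        ≈⟨ ≐-trans L-∪ (∩-cong (L-cong (U-∪-cong (U-cong L-⟪⟫) U-｛｝)) ≐-refl) ⟩
      proj₁ (((ι x ∧ ι z) ∨ ι y) ∧ ι z)
        ≈⟨ modular (ι x ∧ ι z) (ι y) (ι z) proj₂ ⟨
      proj₁ ((ι x ∧ ι z) ∨ (ι y ∧ ι z))
        ≈⟨ L-cong (U-∪-cong (U-cong L-⟪⟫) (U-cong L-⟪⟫)) ⟨
      LU (L ⟪ x , z ⟫ ∪ L ⟪ y , z ⟫)
        ∎

    stronglyModular : IsStronglyModular
    stronglyModular x y z = stronglyModular₁ x y z , stronglyModular₂ x y z

    Mset≐⊙ : ∀ {A} X y → U A ≐ U (proj₁ X) → Mset A y ≐ proj₁ (X ⊙ ι y)
    Mset≐⊙ X y UA≐UX = ≐-trans L-∪ (∩-cong (L-cong (U-∪-cong UA≐UX U-｛′｝)) ≐-refl)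

    -- M x y is Mset ｛ x ｝ y, as ⟪ x , y ′ ⟫ = ｛ x ｝ ∪ ｛ y ′ ｝.
    M≐⊙ : ∀ x y → M x y ≐ proj₁ (ι x ⊙ ι y)
    M≐⊙ x y = Mset≐⊙ (ι x) y U-｛｝

    R≐⇒ : ∀ x y → R x y ≐ proj₁ (ι x ⇒ ι y)
    R≐⇒ x y = L-cong (U-∪-cong (U-cong L-⟪⟫) U-｛′｝)

    isOperatorLeftResiduated : IsOperatorLeftResiduated M R
    isOperatorLeftResiduated = record
      { M-1ʳ     = λ x → ≐-trans (M≐⊙ x 𝟙) (⊙-identityʳ (ι x))
      ; M-1ˡ     = λ x → ≐-trans (M≐⊙ 𝟙 x) (⊙-identityˡ (ι x))
      ; residual = λ x y z → ⇔-trans (⊆-respˡ-≐ (M≐⊙ x y))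
          (⇔-trans (residuated (ι x) (ι y) (ι z)) (⊆-respʳ-≐ (≐-sym (R≐⇒ y z))))
      ; R-0      = λ x → ≐-trans (R≐⇒ x 𝟘) (≐-trans (⇒-⊥ (ι x)) (Lx-* x))
      }

    M-divisible : ∀ x y → Mset (R x y) x ≐ L ⟪ x , y ⟫
    M-divisible x y = begin
      Mset (R x y) x                  ≈⟨ Mset≐⊙ (ι x ⇒ ι y) x (U-cong (R≐⇒ x y)) ⟩
      proj₁ ((ι x ⇒ ι y) ⊙ ι x)       ≈⟨ divisible (ι x) (ι y) ⟩
      proj₁ (ι x ∧ ι y)               ≈⟨ L-⟪⟫ ⟨
      L ⟪ x , y ⟫                     ∎

    isDivisibleLeftResiduated : IsDivisibleLeftResiduatedD₀ _⊙_ _⇒_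
    isDivisibleLeftResiduated = record
      { isLattice  = IsOrtholatticeD₀.isLattice isOrtholattice
      ; ⊥-least    = ⊥D-least
      ; ⊤-greatest = ⊤D-greatest
      ; ⊙-1ʳ       = ⊙-identityʳ
      ; ⊙-1ˡ       = ⊙-identityˡ
      ; residual   = residuated
      ; divisible  = divisible
      }

corollary13 : (𝐏 : Orthoposet) →
    let open Orthoposet 𝐏
        open OrthoposetTheory 𝐏
    in IsModularD₀ →
         IsStronglyModular
       × IsDivisibleOLR (λ x y → L (U ⟪ x , y ′ ⟫ ∪ ｛ y ｝))
                        (λ x y → LU (L ⟪ x , y ⟫ ∪ ｛ x ′ ｝))
       × (Σ[ star ∈ (D₀ → D₀) ]
            (∀ x → proj₁ (star (ι x)) ≐ Lx (x ′))
          × IsOrtholatticeD₀ star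
          × IsModularLattice
          × IsOrthomodularD₀ star
          × IsDivisibleLeftResiduatedD₀
              (λ A B → (A ∨ (star B)) ∧ B)
              (λ A B → (A ∧ B) ∨ (star A)))
corollary13 𝐏 modular =
    stronglyModular
  , (isOperatorLeftResiduated , M-divisible)
  , star , Lx-* , isOrtholattice , modular , (isOrtholattice , orthomodular)
  , isDivisibleLeftResiduated
  where
  open OrthoposetCompletion 𝐏
  open Modular modular
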